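{- For every formula $\varphi\in\mathcal L_{CL}$: $\vdash_{\mathrm{CL^{FI}}}\varphi$ if and only if $\vdash_{\mathrm{CL}}\varphi$.
   Context: Let $N=\{1,\dots,n\}$ be a finite set of agents, $\mathsf{Prop}$ a countable set of atoms. $\mathcal L_{CL}$: $\varphi::=p\mid\neg\varphi\mid(\varphi\wedge\psi)\mid[C]\varphi$; $\mathcal L_{\mathrm{CL^{FI}}}$: $\varphi::=p\mid\neg\varphi\mid(\varphi\wedge\psi)\mid[C]\varphi\mid\mathrm{FI}_C(\varphi)$ ($C\subseteq N$). Coalition Logic $\mathrm{CL}$ (Pauly's axiomatization over $\mathcal L_{CL}$) has: propositional tautologies; $\neg[C]\bot$; $[C]\top$; $\neg[\emptyset]\neg\varphi\to[N]\varphi$; $[C](\varphi\wedge\psi)\to[C]\psi$; $([C_1]\varphi_1\wedge[C_2]\varphi_2)\to[C_1\cup C_2](\varphi_1\wedge\varphi_2)$ for disjoint $C_1,C_2$; rules modus ponens and (RE): from $\vdash\varphi\leftrightarrow\psi$ infer $\vdash[C]\varphi\leftrightarrow[C]\psi$. $\mathrm{CL^{FI}}$ has all these axioms and rules over $\mathcal L_{\mathrm{CL^{FI}}}$ plus the axiom $\mathrm{FI}_C(\varphi)\leftrightarrow(\neg[C]\varphi\wedge\neg[C]\neg\varphi)$. -}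

module Defs where

open import Data.Nat using (ℕ)
open import Data.Bool using (Bool; true; false; not; _∧_)
open import Data.Fin.Subset using (Subset; _∩_; _∪_) renaming (⊥ to ∅ˢ; ⊤ to Nˢ)
open import Relation.Binary.PropositionalEquality using (_≡_)

-- Atoms: Prop = ℕ (countable).  Agents: N = Fin n; coalitions: Subset n.

data FormCL (n : ℕ) : Set where
  atom : ℕ → FormCL n
  ¬'_  : FormCL n → FormCL n
  _∧'_ : FormCL n → FormCL n → FormCL n
  [_]_ : Subset n → FormCL n → FormCL n

data FormFI (n : ℕ) : Set where
  atom : ℕ → FormFI n
  ¬'_  : FormFI n → FormFI n
  _∧'_ : FormFI n → FormFI n → FormFI n
  [_]_ : Subset n → FormFI n → FormFI n
  FI   : Subset n → FormFI n → FormFI n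

embed : ∀ {n} → FormCL n → FormFI n
embed (atom p)  = atom p
embed (¬' φ)    = ¬' embed φ
embed (φ ∧' ψ)  = embed φ ∧' embed ψ
embed ([ C ] φ) = [ C ] embed φ

module CLAbbrev {n : ℕ} where
  ⊥' : FormCL n
  ⊥' = atom 0 ∧' (¬' atom 0)
  ⊤' : FormCL n
  ⊤' = ¬' ⊥'
  _∨'_ : FormCL n → FormCL n → FormCL n
  φ ∨' ψ = ¬' ((¬' φ) ∧' (¬' ψ))
  _⇒_ : FormCL n → FormCL n → FormCL n
  φ ⇒ ψ = ¬' (φ ∧' (¬' ψ))
  _⇔_ : FormCL n → FormCL n → FormCL n
  φ ⇔ ψ = (φ ⇒ ψ) ∧' (ψ ⇒ φ)

module FIAbbrev {n : ℕ} where
  ⊥' : FormFI n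
  ⊥' = atom 0 ∧' (¬' atom 0)
  ⊤' : FormFI n
  ⊤' = ¬' ⊥'
  _⇒_ : FormFI n → FormFI n → FormFI n
  φ ⇒ ψ = ¬' (φ ∧' (¬' ψ))
  _⇔_ : FormFI n → FormFI n → FormFI n
  φ ⇔ ψ = (φ ⇒ ψ) ∧' (ψ ⇒ φ)

-- Propositional tautologies: formulas true under every Boolean
-- assignment to their "propositional atoms", i.e. atoms and modal
-- subformulas ([C]φ, FI_C(φ)) treated as opaque.

evalCL : ∀ {n} → (FormCL n → Bool) → FormCL n → Bool
evalCL v (atom p)  = v (atom p)
evalCL v (¬' φ)    = not (evalCL v φ)
evalCL v (φ ∧' ψ)  = evalCL v φ ∧ evalCL v ψ
evalCL v ([ C ] φ) = v ([ C ] φ)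

TautCL : ∀ {n} → FormCL n → Set
TautCL {n} φ = (v : FormCL n → Bool) → evalCL v φ ≡ true

evalFI : ∀ {n} → (FormFI n → Bool) → FormFI n → Bool
evalFI v (atom p)  = v (atom p)
evalFI v (¬' φ)    = not (evalFI v φ)
evalFI v (φ ∧' ψ)  = evalFI v φ ∧ evalFI v ψ
evalFI v ([ C ] φ) = v ([ C ] φ)
evalFI v (FI C φ)  = v (FI C φ)

TautFI : ∀ {n} → FormFI n → Set
TautFI {n} φ = (v : FormFI n → Bool) → evalFI v φ ≡ true

Disjoint : ∀ {n} → Subset n → Subset n → Set
Disjoint C₁ C₂ = C₁ ∩ C₂ ≡ ∅ˢ

module _ {n : ℕ} where
  open CLAbbrev {n}

  data ⊢CL : FormCL n → Set where
    taut   : ∀ {φ} → TautCL φ → ⊢CL φ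
    ⊥-ax   : ∀ C → ⊢CL (¬' ([ C ] ⊥'))
    ⊤-ax   : ∀ C → ⊢CL ([ C ] ⊤')
    N-max  : ∀ φ → ⊢CL ((¬' ([ ∅ˢ ] (¬' φ))) ⇒ ([ Nˢ ] φ))
    mono   : ∀ C φ ψ → ⊢CL (([ C ] (φ ∧' ψ)) ⇒ ([ C ] ψ))
    super  : ∀ C₁ C₂ φ₁ φ₂ → Disjoint C₁ C₂ →
             ⊢CL ((([ C₁ ] φ₁) ∧' ([ C₂ ] φ₂)) ⇒ ([ C₁ ∪ C₂ ] (φ₁ ∧' φ₂)))
    mp     : ∀ {φ ψ} → ⊢CL φ → ⊢CL (φ ⇒ ψ) → ⊢CL ψ
    re     : ∀ {φ ψ} C → ⊢CL (φ ⇔ ψ) → ⊢CL (([ C ] φ) ⇔ ([ C ] ψ))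

module _ {n : ℕ} where
  open FIAbbrev {n}

  data ⊢FI : FormFI n → Set where
    taut   : ∀ {φ} → TautFI φ → ⊢FI φ
    ⊥-ax   : ∀ C → ⊢FI (¬' ([ C ] ⊥'))
    ⊤-ax   : ∀ C → ⊢FI ([ C ] ⊤')
    N-max  : ∀ φ → ⊢FI ((¬' ([ ∅ˢ ] (¬' φ))) ⇒ ([ Nˢ ] φ))
    mono   : ∀ C φ ψ → ⊢FI (([ C ] (φ ∧' ψ)) ⇒ ([ C ] ψ))
    super  : ∀ C₁ C₂ φ₁ φ₂ → Disjoint C₁ C₂ →
             ⊢FI ((([ C₁ ] φ₁) ∧' ([ C₂ ] φ₂)) ⇒ ([ C₁ ∪ C₂ ] (φ₁ ∧' φ₂)))
    mp     : ∀ {φ ψ} → ⊢FI φ → ⊢FI (φ ⇒ ψ) → ⊢FI ψ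
    re     : ∀ {φ ψ} C → ⊢FI (φ ⇔ ψ) → ⊢FI (([ C ] φ) ⇔ ([ C ] ψ))
    fi-ax  : ∀ C φ → ⊢FI ((FI C φ) ⇔ ((¬' ([ C ] φ)) ∧' (¬' ([ C ] (¬' φ)))))

module Submission where

open import Defs
open import Data.Nat using (ℕ)
open import Data.Product using (_×_; _,_)
open import Data.Bool using (Bool; true; not; _∧_)
open import Data.Bool.Properties using (∧-inverseʳ)
open import Relation.Binary.PropositionalEquality using (_≡_; refl; subst; trans; sym; cong; cong₂)

-- FI is definable in CL, so eliminating it by its defining axiom maps every
-- CL^FI axiom to an instance of the same CL schema (and the FI axiom to an
-- instance of X ⇔ X) while fixing L_CL; conversely every CL derivation is
-- already a CL^FI derivation of the embedded formula.

module _ {n : ℕ} where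
  open CLAbbrev {n}

  eliminateFI : FormFI n → FormCL n
  eliminateFI (atom p)  = atom p
  eliminateFI (¬' φ)    = ¬' eliminateFI φ
  eliminateFI (φ ∧' ψ)  = eliminateFI φ ∧' eliminateFI ψ
  eliminateFI ([ C ] φ) = [ C ] eliminateFI φ
  eliminateFI (FI C φ)  = (¬' ([ C ] eliminateFI φ)) ∧' (¬' ([ C ] (¬' eliminateFI φ)))

  eliminateFI-embed : (φ : FormCL n) → eliminateFI (embed φ) ≡ φ
  eliminateFI-embed (atom p)  = refl
  eliminateFI-embed (¬' φ)    = cong ¬'_ (eliminateFI-embed φ)
  eliminateFI-embed (φ ∧' ψ)  = cong₂ _∧'_ (eliminateFI-embed φ) (eliminateFI-embed ψ)
  eliminateFI-embed ([ C ] φ) = cong ([ C ]_) (eliminateFI-embed φ)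

  evalFI-eliminateFI : (v : FormCL n → Bool) (φ : FormFI n) →
                       evalFI (λ χ → evalCL v (eliminateFI χ)) φ ≡ evalCL v (eliminateFI φ)
  evalFI-eliminateFI v (atom p)  = refl
  evalFI-eliminateFI v (¬' φ)    = cong not (evalFI-eliminateFI v φ)
  evalFI-eliminateFI v (φ ∧' ψ)  = cong₂ _∧_ (evalFI-eliminateFI v φ) (evalFI-eliminateFI v ψ)
  evalFI-eliminateFI v ([ C ] φ) = refl
  evalFI-eliminateFI v (FI C φ)  = refl

  evalCL-embed : (v : FormFI n → Bool) (φ : FormCL n) →
                 evalCL (λ χ → v (embed χ)) φ ≡ evalFI v (embed φ)
  evalCL-embed v (atom p)  = refl
  evalCL-embed v (¬' φ)    = cong not (evalCL-embed v φ)
  evalCL-embed v (φ ∧' ψ)  = cong₂ _∧_ (evalCL-embed v φ) (evalCL-embed v ψ)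
  evalCL-embed v ([ C ] φ) = refl

  TautCL-eliminateFI : {φ : FormFI n} → TautFI φ → TautCL (eliminateFI φ)
  TautCL-eliminateFI {φ} t v = trans (sym (evalFI-eliminateFI v φ)) (t _)

  TautFI-embed : {φ : FormCL n} → TautCL φ → TautFI (embed φ)
  TautFI-embed {φ} t v = trans (sym (evalCL-embed v φ)) (t _)

  TautCL-⇔-refl : (χ : FormCL n) → TautCL (χ ⇔ χ)
  TautCL-⇔-refl χ v = cong (λ b → not b ∧ not b) (∧-inverseʳ (evalCL v χ))

  ⊢CL-eliminateFI : {φ : FormFI n} → ⊢FI φ → ⊢CL (eliminateFI φ)
  ⊢CL-eliminateFI (taut {φ} t)           = taut (TautCL-eliminateFI {φ} t)
  ⊢CL-eliminateFI (⊥-ax C)               = ⊥-ax C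
  ⊢CL-eliminateFI (⊤-ax C)               = ⊤-ax C
  ⊢CL-eliminateFI (N-max φ)              = N-max (eliminateFI φ)
  ⊢CL-eliminateFI (mono C φ ψ)           = mono C (eliminateFI φ) (eliminateFI ψ)
  ⊢CL-eliminateFI (super C₁ C₂ φ₁ φ₂ d)  = super C₁ C₂ (eliminateFI φ₁) (eliminateFI φ₂) d
  ⊢CL-eliminateFI (mp d e)               = mp (⊢CL-eliminateFI d) (⊢CL-eliminateFI e)
  ⊢CL-eliminateFI (re C d)               = re C (⊢CL-eliminateFI d)
  ⊢CL-eliminateFI (fi-ax C φ)            =
    taut (TautCL-⇔-refl ((¬' ([ C ] eliminateFI φ)) ∧' (¬' ([ C ] (¬' eliminateFI φ)))))

  ⊢FI-embed : {φ : FormCL n} → ⊢CL φ → ⊢FI (embed φ)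
  ⊢FI-embed (taut {φ} t)          = taut (TautFI-embed {φ} t)
  ⊢FI-embed (⊥-ax C)              = ⊥-ax C
  ⊢FI-embed (⊤-ax C)              = ⊤-ax C
  ⊢FI-embed (N-max φ)             = N-max (embed φ)
  ⊢FI-embed (mono C φ ψ)          = mono C (embed φ) (embed ψ)
  ⊢FI-embed (super C₁ C₂ φ₁ φ₂ d) = super C₁ C₂ (embed φ₁) (embed φ₂) d
  ⊢FI-embed (mp d e)              = mp (⊢FI-embed d) (⊢FI-embed e)
  ⊢FI-embed (re C d)              = re C (⊢FI-embed d)

theorem7p8 : ∀ (n : ℕ) (φ : FormCL n) → (⊢FI (embed φ) → ⊢CL φ) × (⊢CL φ → ⊢FI (embed φ))
theorem7p8 n φ = (λ d → subst ⊢CL (eliminateFI-embed φ) (⊢CL-eliminateFI d)) , ⊢FI-embed
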